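{- Let $\Gamma$ be the Sims-Gewirtz graph (the strongly regular graph with parameters $(56,10,0,2)$) on vertices $v_1,\dots,v_{56}$. Suppose $q(\Gamma)=2$ and let $M\in\mathcal S(\Gamma)$ satisfy $M=[\langle f_i,f_j\rangle]$ for some vectors $f_i\in\mathbb R^d$ and $M^2=M$. For an edge $e=(v_i,v_j)$ let $s(e)=\operatorname{sgn}(M_{ij})$. Then every crossbar 6-cycle $C$ of $\Gamma$ is even, i.e. $\prod_{e\in E(C)}s(e)=1$.
   Context: $\mathcal S(G)$ is the set of real symmetric matrices whose off-diagonal entry $(i,j)$ is nonzero exactly when $v_i\sim v_j$ (diagonal unrestricted); $q(G)$ is the minimum number of distinct eigenvalues of a matrix in $\mathcal S(G)$. A crossbar 6-cycle is a 6-cycle with consecutive edges $a,b,c,d,e,f$ (with $f$ incident to $a$) such that there is an additional edge $g$ of the graph joining the common vertex of $b,c$ to the common vertex of $e,f$ (so $a,b,g,f$ and $g,c,d,e$ form two 4-cycles). -}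

module Defs where

open import Data.Nat using (ℕ; zero; suc) renaming (_≤_ to _≤ℕ_)
open import Data.Fin using (Fin)
open import Data.Fin.Properties using () renaming (_≟_ to _≟ᶠ_)
open import Data.Bool using (Bool; true; false; T; _∧_; if_then_else_; not)
open import Data.List using (List; []; _∷_; length; foldr; filterᵇ; allFin)
open import Data.List.Membership.Propositional using (_∈_)
open import Data.List.Relation.Unary.AllPairs using (AllPairs)
open import Data.List.Relation.Unary.All using (All)
open import Data.Integer using (ℤ) renaming (_*_ to _*ℤ_; +_ to +ℤ_; -_ to -ℤ_)
open import Data.Product using (Σ; ∃; _×_; _,_)
open import Data.Sum using (_⊎_)
open import Relation.Binary.PropositionalEquality using (_≡_; _≢_)
open import Relation.Binary.Definitions using (Trichotomous; tri<; tri≈; tri>)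
open import Relation.Nullary using (¬_)

-- The real numbers, axiomatised as a Dedekind-complete ordered field
-- (unique up to isomorphism, so quantifying over all models is the same
-- as talking about ℝ).

record CompleteOrderedField : Set₁ where
  infixl 6 _+_
  infixl 7 _*_
  infix 4 _<_ _≤_
  field
    Carrier : Set
    0# 1#   : Carrier
    _+_ _*_ : Carrier → Carrier → Carrier
    -_      : Carrier → Carrier
    _<_     : Carrier → Carrier → Set
    inv     : (x : Carrier) → x ≢ 0# → Carrier
    +-assoc   : ∀ x y z → (x + y) + z ≡ x + (y + z)
    +-comm    : ∀ x y → x + y ≡ y + x
    +-identityˡ : ∀ x → 0# + x ≡ x
    +-inverseˡ  : ∀ x → (- x) + x ≡ 0#
    *-assoc   : ∀ x y z → (x * y) * z ≡ x * (y * z)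
    *-comm    : ∀ x y → x * y ≡ y * x
    *-identityˡ : ∀ x → 1# * x ≡ x
    *-inverseˡ  : ∀ x (p : x ≢ 0#) → inv x p * x ≡ 1#
    distribˡ  : ∀ x y z → x * (y + z) ≡ x * y + x * z
    0≢1       : 0# ≢ 1#
    <-trans   : ∀ {x y z} → x < y → y < z → x < z
    <-irrefl  : ∀ {x} → ¬ (x < x)
    compare   : Trichotomous _≡_ _<_
    +-monoˡ-< : ∀ {x y} z → x < y → x + z < y + z
    *-pos     : ∀ {x y} → 0# < x → 0# < y → 0# < x * y
  _≤_ : Carrier → Carrier → Set
  x ≤ y = x < y ⊎ x ≡ y
  field
    sup : (P : Carrier → Set) → ∃ P → (∃ λ b → ∀ x → P x → x ≤ b) →
          ∃ λ s → (∀ x → P x → x ≤ s) × (∀ b → (∀ x → P x → x ≤ b) → s ≤ b)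

module _ (R : CompleteOrderedField) where
  open CompleteOrderedField R

  Σ[_] : (d : ℕ) → (Fin d → Carrier) → Carrier
  Σ[ d ] f = foldr (λ k acc → f k + acc) 0# (allFin d)

  Matrix : ℕ → Set
  Matrix n = Fin n → Fin n → Carrier

  _·_ : ∀ {n} → Matrix n → Matrix n → Matrix n
  _·_ {n} A B i j = Σ[ n ] (λ k → A i k * B k j)

  sgn : Carrier → ℤ
  sgn x with compare 0# x
  ... | tri< _ _ _ = +ℤ 1
  ... | tri≈ _ _ _ = +ℤ 0
  ... | tri> _ _ _ = -ℤ (+ℤ 1)

record Graph (n : ℕ) : Set where
  field
    adj     : Fin n → Fin n → Bool
    sym     : ∀ i j → adj i j ≡ adj j i
    irrefl  : ∀ i → adj i i ≡ false

open Graph public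

_∼[_]_ : ∀ {n} → Fin n → Graph n → Fin n → Set
i ∼[ G ] j = T (adj G i j)

degree : ∀ {n} → Graph n → Fin n → ℕ
degree {n} G i = length (filterᵇ (adj G i) (allFin n))

commonNbrs : ∀ {n} → Graph n → Fin n → Fin n → ℕ
commonNbrs {n} G i j = length (filterᵇ (λ k → adj G i k ∧ adj G k j) (allFin n))

IsSRG : (n : ℕ) → Graph n → (k λ' μ : ℕ) → Set
IsSRG n G k λ' μ =
  (∀ i → degree G i ≡ k) ×
  (∀ i j → i ∼[ G ] j → commonNbrs G i j ≡ λ') ×
  (∀ i j → i ≢ j → ¬ (i ∼[ G ] j) → commonNbrs G i j ≡ μ)

module _ (R : CompleteOrderedField) where
  open CompleteOrderedField R

  InS : ∀ {n} → Graph n → Matrix R n → Set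
  InS G M = (∀ i j → M i j ≡ M j i) ×
            (∀ i j → i ≢ j → (M i j ≢ 0# → i ∼[ G ] j) × (i ∼[ G ] j → M i j ≢ 0#))

  IsEigenvalue : ∀ {n} → Matrix R n → Carrier → Set
  IsEigenvalue {n} M λ' = Σ (Fin n → Carrier) λ v →
    (∃ λ i → v i ≢ 0#) × (∀ i → Σ[_] R n (λ k → M i k * v k) ≡ λ' * v i)

  NumDistinctEigenvalues : ∀ {n} → Matrix R n → ℕ → Set
  NumDistinctEigenvalues M m = Σ (List Carrier) λ ls →
    length ls ≡ m × AllPairs _≢_ ls × All (IsEigenvalue M) ls ×
    (∀ μ → IsEigenvalue M μ → μ ∈ ls)

  qEquals : ∀ {n} → Graph n → ℕ → Set
  qEquals G m =
    (Σ (Matrix R _) λ M → InS G M × NumDistinctEigenvalues M m) ×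
    (∀ M → InS G M → ∀ m' → NumDistinctEigenvalues M m' → m ≤ℕ m')

  IsGram : ∀ {n} → Matrix R n → Set
  IsGram {n} M = Σ ℕ λ d → Σ (Fin n → Fin d → Carrier) λ f →
    ∀ i j → M i j ≡ Σ[_] R d (λ k → f i k * f j k)

record Crossbar6 {n : ℕ} (G : Graph n) : Set where
  field
    u₀ u₁ u₂ u₃ u₄ u₅ : Fin n
    distinct : AllPairs _≢_ (u₀ ∷ u₁ ∷ u₂ ∷ u₃ ∷ u₄ ∷ u₅ ∷ [])
    ea : u₀ ∼[ G ] u₁
    eb : u₁ ∼[ G ] u₂
    ec : u₂ ∼[ G ] u₃
    ed : u₃ ∼[ G ] u₄
    ee : u₄ ∼[ G ] u₅
    ef : u₅ ∼[ G ] u₀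
    eg : u₂ ∼[ G ] u₅

open Crossbar6 public

module _ (R : CompleteOrderedField) where
  open CompleteOrderedField R

  IsEvenCycle : ∀ {n} {G : Graph n} → Matrix R n → Crossbar6 G → Set
  IsEvenCycle M C =
    s (u₀ C) (u₁ C) *ℤ s (u₁ C) (u₂ C) *ℤ s (u₂ C) (u₃ C) *ℤ
    s (u₃ C) (u₄ C) *ℤ s (u₄ C) (u₅ C) *ℤ s (u₅ C) (u₀ C) ≡ +ℤ 1
    where s = λ i j → sgn R (M i j)

-- Since M² = M and M is supported on the edges of Γ, for two distinct
-- non-adjacent vertices i, j the entry 0 = M i j = (M²) i j is a sum over the
-- common neighbours of i and j; as μ = 2 there are exactly two of them, a and
-- b, so M i a M a j = - M i b M b j.  Every induced 4-cycle therefore has an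
-- odd sign product, and a crossbar 6-cycle, the symmetric difference of two
-- 4-cycles sharing the crossbar, has an even one.
module Submission where

open import Defs hiding (sym; u₀; u₁; u₂; u₃; u₄; u₅; distinct; ea; eb; ec; ed; ee; ef; eg)
open import Data.Fin using (Fin)
open import Data.Product using (_×_)
open import Relation.Binary.PropositionalEquality using (_≡_)

open import Data.Nat using (ℕ)
open import Data.Bool using (Bool; true; false; T; _∧_)
open import Data.Unit using (tt)
open import Data.Empty using (⊥-elim)
open import Data.Product using (_,_; proj₁; proj₂)
open import Data.Sum using (_⊎_; inj₁; inj₂)
open import Data.Fin.Properties using () renaming (_≟_ to _≟ᶠ_)
open import Data.List using (List; []; _∷_; length; foldr; filterᵇ; allFin)
open import Data.List.Membership.Propositional using (_∈_)
open import Data.List.Membership.Propositional.Properties using (∈-filter⁺; ∈-allFin)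
open import Data.List.Relation.Unary.Any using (here; there)
open import Data.List.Relation.Unary.All using (_∷_) renaming (lookup to lookupᴬ)
open import Data.List.Relation.Unary.AllPairs using (_∷_)
open import Data.List.Relation.Unary.Unique.Propositional using (Unique)
open import Data.List.Relation.Unary.Unique.Propositional.Properties using (allFin⁺)
open import Relation.Binary.PropositionalEquality
  using (_≢_; refl; sym; trans; cong; cong₂; subst; subst₂; module ≡-Reasoning)
open import Relation.Binary.Definitions using (tri<; tri≈; tri>)
open import Relation.Nullary using (¬_; Dec; yes; no)
open import Relation.Nullary.Decidable.Core using (T?)
import Data.Integer as ℤ
open import Data.Integer.Tactic.RingSolver using (solve-∀)

crossbar-sign-product : ∀ (a b c d e f g : ℤ.ℤ) →
  a ℤ.* b ≡ ℤ.- (f ℤ.* g) → c ℤ.* d ≡ ℤ.- (g ℤ.* e) →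
  e ℤ.* e ≡ ℤ.+ 1 → f ℤ.* f ≡ ℤ.+ 1 → g ℤ.* g ≡ ℤ.+ 1 →
  a ℤ.* b ℤ.* c ℤ.* d ℤ.* e ℤ.* f ≡ ℤ.+ 1
crossbar-sign-product a b c d e f g ab≡-fg cd≡-ge e²≡1 f²≡1 g²≡1 = begin
  a ℤ.* b ℤ.* c ℤ.* d ℤ.* e ℤ.* f
    ≡⟨ regroup a b c d e f ⟩
  (a ℤ.* b) ℤ.* (c ℤ.* d) ℤ.* e ℤ.* f
    ≡⟨ cong₂ (λ x y → x ℤ.* y ℤ.* e ℤ.* f) ab≡-fg cd≡-ge ⟩
  ℤ.- (f ℤ.* g) ℤ.* ℤ.- (g ℤ.* e) ℤ.* e ℤ.* f
    ≡⟨ squares e f g ⟩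
  (e ℤ.* e) ℤ.* (f ℤ.* f) ℤ.* (g ℤ.* g)
    ≡⟨ cong₂ ℤ._*_ (cong₂ ℤ._*_ e²≡1 f²≡1) g²≡1 ⟩
  ℤ.+ 1 ∎
  where
  open ≡-Reasoning
  regroup : ∀ (a b c d e f : ℤ.ℤ) →
    a ℤ.* b ℤ.* c ℤ.* d ℤ.* e ℤ.* f ≡ (a ℤ.* b) ℤ.* (c ℤ.* d) ℤ.* e ℤ.* f
  regroup = solve-∀
  squares : ∀ (e f g : ℤ.ℤ) →
    ℤ.- (f ℤ.* g) ℤ.* ℤ.- (g ℤ.* e) ℤ.* e ℤ.* f ≡ (e ℤ.* e) ℤ.* (f ℤ.* f) ℤ.* (g ℤ.* g)
  squares = solve-∀

∈-length-2 : ∀ {A : Set} {xs : List A} {a b k : A} → length xs ≡ 2 →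
  a ∈ xs → b ∈ xs → a ≢ b → k ∈ xs → k ≡ a ⊎ k ≡ b
∈-length-2 {xs = _ ∷ _ ∷ []} refl (here refl) (here refl) a≢b _ = ⊥-elim (a≢b refl)
∈-length-2 {xs = _ ∷ _ ∷ []} refl (here refl) (there (here refl)) _ (here refl) = inj₁ refl
∈-length-2 {xs = _ ∷ _ ∷ []} refl (here refl) (there (here refl)) _ (there (here refl)) = inj₂ refl
∈-length-2 {xs = _ ∷ _ ∷ []} refl (there (here refl)) (here refl) _ (here refl) = inj₂ refl
∈-length-2 {xs = _ ∷ _ ∷ []} refl (there (here refl)) (here refl) _ (there (here refl)) = inj₁ refl
∈-length-2 {xs = _ ∷ _ ∷ []} refl (there (here refl)) (there (here refl)) a≢b _ = ⊥-elim (a≢b refl)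

∉-length-0 : ∀ {A : Set} {xs : List A} {a : A} → length xs ≡ 0 → ¬ (a ∈ xs)
∉-length-0 {xs = []} refl ()

module OrderedFieldProperties (R : CompleteOrderedField) where
  open CompleteOrderedField R
  open ≡-Reasoning

  +-identityʳ : ∀ x → x + 0# ≡ x
  +-identityʳ x = trans (+-comm x 0#) (+-identityˡ x)

  +-inverseʳ : ∀ x → x + - x ≡ 0#
  +-inverseʳ x = trans (+-comm x (- x)) (+-inverseˡ x)

  -‿unique : ∀ x y → x + y ≡ 0# → y ≡ - x
  -‿unique x y x+y≡0 = begin
    y               ≡⟨ sym (+-identityˡ y) ⟩
    0# + y          ≡⟨ cong (_+ y) (sym (+-inverseˡ x)) ⟩
    (- x + x) + y   ≡⟨ +-assoc (- x) x y ⟩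
    - x + (x + y)   ≡⟨ cong (- x +_) x+y≡0 ⟩
    - x + 0#        ≡⟨ +-identityʳ (- x) ⟩
    - x             ∎

  -‿involutive : ∀ x → - (- x) ≡ x
  -‿involutive x = sym (-‿unique (- x) x (+-inverseˡ x))

  zeroʳ : ∀ x → x * 0# ≡ 0#
  zeroʳ x = begin
    x * 0#                          ≡⟨ sym (+-identityˡ (x * 0#)) ⟩
    0# + x * 0#                     ≡⟨ cong (_+ x * 0#) (sym (+-inverseˡ (x * 0#))) ⟩
    (- (x * 0#) + x * 0#) + x * 0#  ≡⟨ +-assoc (- (x * 0#)) (x * 0#) (x * 0#) ⟩
    - (x * 0#) + (x * 0# + x * 0#)  ≡⟨ cong (- (x * 0#) +_) x0+x0≡x0 ⟩
    - (x * 0#) + x * 0#             ≡⟨ +-inverseˡ (x * 0#) ⟩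
    0#                              ∎
    where
    x0+x0≡x0 : x * 0# + x * 0# ≡ x * 0#
    x0+x0≡x0 = trans (sym (distribˡ x 0# 0#)) (cong (x *_) (+-identityʳ 0#))

  zeroˡ : ∀ x → 0# * x ≡ 0#
  zeroˡ x = trans (*-comm 0# x) (zeroʳ x)

  -‿distribˡ-* : ∀ x y → - x * y ≡ - (x * y)
  -‿distribˡ-* x y = -‿unique (x * y) (- x * y) (begin
    x * y + - x * y     ≡⟨ cong₂ _+_ (*-comm x y) (*-comm (- x) y) ⟩
    y * x + y * - x     ≡⟨ distribˡ y x (- x) ⟨
    y * (x + - x)       ≡⟨ cong (y *_) (+-inverseʳ x) ⟩
    y * 0#              ≡⟨ zeroʳ y ⟩
    0#                  ∎)

  -‿distribʳ-* : ∀ x y → x * - y ≡ - (x * y)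
  -‿distribʳ-* x y = trans (*-comm x (- y)) (trans (-‿distribˡ-* y x) (cong -_ (*-comm y x)))

  -‿*-‿ : ∀ x y → - x * - y ≡ x * y
  -‿*-‿ x y = trans (-‿distribˡ-* x (- y)) (trans (cong -_ (-‿distribʳ-* x y)) (-‿involutive (x * y)))

  pos⇒-neg : ∀ {x} → 0# < x → - x < 0#
  pos⇒-neg {x} 0<x = subst₂ _<_ (+-identityˡ (- x)) (+-inverseʳ x) (+-monoˡ-< (- x) 0<x)

  neg⇒-pos : ∀ {x} → x < 0# → 0# < - x
  neg⇒-pos {x} x<0 = subst₂ _<_ (+-inverseʳ x) (+-identityˡ (- x)) (+-monoˡ-< (- x) x<0)

  -pos⇒neg : ∀ {x} → 0# < - x → x < 0#
  -pos⇒neg {x} 0<-x = subst₂ _<_ (+-identityˡ x) (+-inverseˡ x) (+-monoˡ-< x 0<-x)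

  _≟0 : ∀ x → Dec (x ≡ 0#)
  x ≟0 with compare 0# x
  ... | tri< 0<x _ _ = no λ { refl → <-irrefl 0<x }
  ... | tri≈ _ 0≡x _ = yes (sym 0≡x)
  ... | tri> _ _ x<0 = no λ { refl → <-irrefl x<0 }

  data SignView (x : Carrier) : Set where
    positive : 0# < x → SignView x
    negative : x < 0# → SignView x

  signView : ∀ {x} → x ≢ 0# → SignView x
  signView {x} x≢0 with compare 0# x
  ... | tri< 0<x _ _ = positive 0<x
  ... | tri≈ _ 0≡x _ = ⊥-elim (x≢0 (sym 0≡x))
  ... | tri> _ _ x<0 = negative x<0

  signView⇒≢0 : ∀ {x} → SignView x → x ≢ 0#
  signView⇒≢0 (positive 0<x) refl = <-irrefl 0<x
  signView⇒≢0 (negative x<0) refl = <-irrefl x<0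

  signView-* : ∀ {x y} → SignView x → SignView y → SignView (x * y)
  signView-* (positive 0<x) (positive 0<y) = positive (*-pos 0<x 0<y)
  signView-* {x} {y} (positive 0<x) (negative y<0) =
    negative (-pos⇒neg (subst (0# <_) (-‿distribʳ-* x y) (*-pos 0<x (neg⇒-pos y<0))))
  signView-* {x} {y} (negative x<0) (positive 0<y) =
    negative (-pos⇒neg (subst (0# <_) (-‿distribˡ-* x y) (*-pos (neg⇒-pos x<0) 0<y)))
  signView-* {x} {y} (negative x<0) (negative y<0) =
    positive (subst (0# <_) (-‿*-‿ x y) (*-pos (neg⇒-pos x<0) (neg⇒-pos y<0)))

  signView-‿ : ∀ {x} → SignView x → SignView (- x)
  signView-‿ (positive 0<x) = negative (pos⇒-neg 0<x)
  signView-‿ (negative x<0) = positive (neg⇒-pos x<0)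

  *-≢0 : ∀ {x y} → x ≢ 0# → y ≢ 0# → x * y ≢ 0#
  *-≢0 x≢0 y≢0 = signView⇒≢0 (signView-* (signView x≢0) (signView y≢0))

  sign : ∀ {x} → SignView x → ℤ.ℤ
  sign (positive _) = ℤ.+ 1
  sign (negative _) = ℤ.- ℤ.+ 1

  sgn≡sign : ∀ {x} (v : SignView x) → sgn R x ≡ sign v
  sgn≡sign {x} (positive 0<x) with compare 0# x
  ... | tri< _ _ _     = refl
  ... | tri≈ _ 0≡x _   = ⊥-elim (<-irrefl (subst (0# <_) (sym 0≡x) 0<x))
  ... | tri> _ _ x<0   = ⊥-elim (<-irrefl (<-trans 0<x x<0))
  sgn≡sign {x} (negative x<0) with compare 0# x
  ... | tri< 0<x _ _   = ⊥-elim (<-irrefl (<-trans x<0 0<x))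
  ... | tri≈ _ 0≡x _   = ⊥-elim (<-irrefl (subst (_< 0#) (sym 0≡x) x<0))
  ... | tri> _ _ _     = refl

  sign-* : ∀ {x y} (vx : SignView x) (vy : SignView y) → sign (signView-* vx vy) ≡ sign vx ℤ.* sign vy
  sign-* (positive _) (positive _) = refl
  sign-* (positive _) (negative _) = refl
  sign-* (negative _) (positive _) = refl
  sign-* (negative _) (negative _) = refl

  sign-‿ : ∀ {x} (v : SignView x) → sign (signView-‿ v) ≡ ℤ.- sign v
  sign-‿ (positive _) = refl
  sign-‿ (negative _) = refl

  sign²≡1 : ∀ {x} (v : SignView x) → sign v ℤ.* sign v ≡ ℤ.+ 1
  sign²≡1 (positive _) = refl
  sign²≡1 (negative _) = refl

  sgn-* : ∀ {x y} → x ≢ 0# → y ≢ 0# → sgn R (x * y) ≡ sgn R x ℤ.* sgn R y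
  sgn-* x≢0 y≢0 = begin
    sgn R (_ * _)              ≡⟨ sgn≡sign (signView-* vx vy) ⟩
    sign (signView-* vx vy)    ≡⟨ sign-* vx vy ⟩
    sign vx ℤ.* sign vy        ≡⟨ cong₂ ℤ._*_ (sgn≡sign vx) (sgn≡sign vy) ⟨
    sgn R _ ℤ.* sgn R _        ∎
    where
    vx = signView x≢0
    vy = signView y≢0

  sgn-‿ : ∀ {x} → x ≢ 0# → sgn R (- x) ≡ ℤ.- sgn R x
  sgn-‿ x≢0 = begin
    sgn R (- _)              ≡⟨ sgn≡sign (signView-‿ v) ⟩
    sign (signView-‿ v)      ≡⟨ sign-‿ v ⟩
    ℤ.- sign v               ≡⟨ cong ℤ.-_ (sgn≡sign v) ⟨
    ℤ.- sgn R _              ∎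
    where v = signView x≢0

  sgn²≡1 : ∀ {x} → x ≢ 0# → sgn R x ℤ.* sgn R x ≡ ℤ.+ 1
  sgn²≡1 x≢0 = trans (cong₂ ℤ._*_ (sgn≡sign v) (sgn≡sign v)) (sign²≡1 v)
    where v = signView x≢0

  -- Σ[ d ] f from Defs unfolds to sumᴸ f (allFin d).
  sumᴸ : ∀ {A : Set} → (A → Carrier) → List A → Carrier
  sumᴸ f = foldr (λ k acc → f k + acc) 0#

  sumᴸ-zero : ∀ {A : Set} (f : A → Carrier) xs → (∀ {k} → k ∈ xs → f k ≡ 0#) → sumᴸ f xs ≡ 0#
  sumᴸ-zero f [] _ = refl
  sumᴸ-zero f (x ∷ xs) f≡0 =
    trans (cong₂ _+_ (f≡0 (here refl)) (sumᴸ-zero f xs λ k∈xs → f≡0 (there k∈xs))) (+-identityʳ 0#)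

  sumᴸ-single : ∀ {A : Set} (f : A → Carrier) {xs a} → Unique xs → a ∈ xs →
    (∀ {k} → k ∈ xs → k ≢ a → f k ≡ 0#) → sumᴸ f xs ≡ f a
  sumᴸ-single f {x ∷ xs} (x∉xs ∷ _) (here refl) vanish =
    trans (cong (f x +_) (sumᴸ-zero f xs λ k∈xs → vanish (there k∈xs) λ { refl → lookupᴬ x∉xs k∈xs refl }))
      (+-identityʳ (f x))
  sumᴸ-single f {x ∷ xs} (x∉xs ∷ xs!) (there a∈xs) vanish =
    trans (cong₂ _+_ (vanish (here refl) (lookupᴬ x∉xs a∈xs))
                     (sumᴸ-single f xs! a∈xs λ k∈xs → vanish (there k∈xs)))
      (+-identityˡ _)

  sumᴸ-pair : ∀ {A : Set} (f : A → Carrier) {xs a b} → Unique xs → a ∈ xs → b ∈ xs → a ≢ b →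
    (∀ {k} → k ∈ xs → k ≢ a → k ≢ b → f k ≡ 0#) → sumᴸ f xs ≡ f a + f b
  sumᴸ-pair f (_ ∷ _) (here refl) (here refl) a≢b _ = ⊥-elim (a≢b refl)
  sumᴸ-pair f {x ∷ _} (x∉xs ∷ xs!) (here refl) (there b∈xs) _ vanish =
    cong (f x +_) (sumᴸ-single f xs! b∈xs λ k∈xs → vanish (there k∈xs) λ { refl → lookupᴬ x∉xs k∈xs refl })
  sumᴸ-pair f {x ∷ _} (x∉xs ∷ xs!) (there a∈xs) (here refl) _ vanish =
    trans (cong (f x +_) (sumᴸ-single f xs! a∈xs λ k∈xs k≢a →
                            vanish (there k∈xs) k≢a λ { refl → lookupᴬ x∉xs k∈xs refl }))
      (+-comm (f x) _)
  sumᴸ-pair f {x ∷ _} (x∉xs ∷ xs!) (there a∈xs) (there b∈xs) a≢b vanish =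
    trans (cong₂ _+_ (vanish (here refl) (lookupᴬ x∉xs a∈xs) (lookupᴬ x∉xs b∈xs))
                     (sumᴸ-pair f xs! a∈xs b∈xs a≢b λ k∈xs → vanish (there k∈xs)))
      (+-identityˡ _)

module _ {n : ℕ} (G : Graph n) where

  ∼-sym : ∀ {i j} → i ∼[ G ] j → j ∼[ G ] i
  ∼-sym {i} {j} = subst T (Graph.sym G i j)

  ∼⇒≢ : ∀ {i j} → i ∼[ G ] j → i ≢ j
  ∼⇒≢ {i} i∼i refl = subst T (Graph.irrefl G i) i∼i

  commonNbrList : Fin n → Fin n → List (Fin n)
  commonNbrList i j = filterᵇ (λ k → adj G i k ∧ adj G k j) (allFin n)

  ∈-commonNbrList : ∀ {i j k} → i ∼[ G ] k → k ∼[ G ] j → k ∈ commonNbrList i j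
  ∈-commonNbrList {i} {j} {k} i∼k k∼j =
    ∈-filter⁺ (λ k → T? (adj G i k ∧ adj G k j)) (∈-allFin k) (both i∼k k∼j)
    where
    both : ∀ {p q : Bool} → T p → T q → T (p ∧ q)
    both {true} {true} _ _ = tt

module IdempotentPattern (R : CompleteOrderedField) {n : ℕ} (G : Graph n)
  (triangle-free : ∀ i j → i ∼[ G ] j → commonNbrs G i j ≡ 0)
  (two-common : ∀ i j → i ≢ j → ¬ (i ∼[ G ] j) → commonNbrs G i j ≡ 2)
  (M : Matrix R n) (M∈S : InS R G M) (M²≡M : ∀ i j → (_·_ R M M) i j ≡ M i j) where
  open CompleteOrderedField R
  open OrderedFieldProperties R

  s : Fin n → Fin n → ℤ.ℤ
  s i j = sgn R (M i j)

  s-sym : ∀ i j → s i j ≡ s j i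
  s-sym i j = cong (sgn R) (proj₁ M∈S i j)

  M≢0 : ∀ {i j} → i ∼[ G ] j → M i j ≢ 0#
  M≢0 {i} {j} i∼j = proj₂ (proj₂ M∈S i j (∼⇒≢ G i∼j)) i∼j

  M≡0 : ∀ {i j} → i ≢ j → ¬ (i ∼[ G ] j) → M i j ≡ 0#
  M≡0 {i} {j} i≢j i≁j with M i j ≟0
  ... | yes Mij≡0 = Mij≡0
  ... | no Mij≢0  = ⊥-elim (i≁j (proj₁ (proj₂ M∈S i j i≢j) Mij≢0))

  s²≡1 : ∀ {i j} → i ∼[ G ] j → s i j ℤ.* s i j ≡ ℤ.+ 1
  s²≡1 i∼j = sgn²≡1 (M≢0 i∼j)

  ≁-via : ∀ {i j k} → i ∼[ G ] k → k ∼[ G ] j → ¬ (i ∼[ G ] j)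
  ≁-via {i} {j} i∼k k∼j i∼j = ∉-length-0 (triangle-free i j i∼j) (∈-commonNbrList G i∼k k∼j)

  -- Only the two common neighbours contribute to (M²) i j.
  four-cycle-sign : ∀ {i a j b} → i ∼[ G ] a → a ∼[ G ] j → i ∼[ G ] b → b ∼[ G ] j →
    a ≢ b → i ≢ j → s i a ℤ.* s a j ≡ ℤ.- (s i b ℤ.* s b j)
  four-cycle-sign {i} {a} {j} {b} i∼a a∼j i∼b b∼j a≢b i≢j = begin
    s i a ℤ.* s a j       ≡⟨ sgn-* (M≢0 i∼a) (M≢0 a∼j) ⟨
    sgn R (walk a)        ≡⟨ cong (sgn R) walk-a≡-walk-b ⟩
    sgn R (- walk b)      ≡⟨ sgn-‿ (*-≢0 (M≢0 i∼b) (M≢0 b∼j)) ⟩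
    ℤ.- sgn R (walk b)    ≡⟨ cong ℤ.-_ (sgn-* (M≢0 i∼b) (M≢0 b∼j)) ⟩
    ℤ.- (s i b ℤ.* s b j) ∎
    where
    open ≡-Reasoning
    i≁j = ≁-via i∼a a∼j
    Mij≡0 = M≡0 i≢j i≁j

    walk : Fin n → Carrier
    walk k = M i k * M k j

    other-walk≡0 : ∀ {k} → k ∈ allFin n → k ≢ a → k ≢ b → walk k ≡ 0#
    other-walk≡0 {k} _ k≢a k≢b with k ≟ᶠ i | k ≟ᶠ j
    ... | yes refl | _      = trans (cong (M i i *_) Mij≡0) (zeroʳ _)
    ... | no _     | yes refl = trans (cong (_* M j j) Mij≡0) (zeroˡ _)
    ... | no k≢i   | no k≢j with T? (adj G i k) | T? (adj G k j)
    ...   | no i≁k  | _       = trans (cong (_* M k j) (M≡0 (λ i≡k → k≢i (sym i≡k)) i≁k)) (zeroˡ _)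
    ...   | yes _   | no k≁j  = trans (cong (M i k *_) (M≡0 k≢j k≁j)) (zeroʳ _)
    ...   | yes i∼k | yes k∼j
      with ∈-length-2 (two-common i j i≢j i≁j) (∈-commonNbrList G i∼a a∼j)
                      (∈-commonNbrList G i∼b b∼j) a≢b (∈-commonNbrList G i∼k k∼j)
    ...     | inj₁ k≡a = ⊥-elim (k≢a k≡a)
    ...     | inj₂ k≡b = ⊥-elim (k≢b k≡b)

    walk-b+walk-a≡0 : walk b + walk a ≡ 0#
    walk-b+walk-a≡0 = begin
      walk b + walk a       ≡⟨ +-comm (walk b) (walk a) ⟩
      walk a + walk b       ≡⟨ sumᴸ-pair walk (allFin⁺ n) (∈-allFin a) (∈-allFin b) a≢b other-walk≡0 ⟨
      sumᴸ walk (allFin n)  ≡⟨ M²≡M i j ⟩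
      M i j                 ≡⟨ Mij≡0 ⟩
      0#                    ∎

    walk-a≡-walk-b : walk a ≡ - walk b
    walk-a≡-walk-b = -‿unique (walk b) (walk a) walk-b+walk-a≡0

  crossbar-even : (C : Crossbar6 G) → IsEvenCycle R M C
  crossbar-even C =
    crossbar-sign-product (s u₀ u₁) (s u₁ u₂) (s u₂ u₃) (s u₃ u₄) (s u₄ u₅) (s u₅ u₀) (s u₂ u₅)
      left-square right-square (s²≡1 ee) (s²≡1 ef) (s²≡1 eg)
    where
    open Crossbar6 C
    open ≡-Reasoning
    u₀≢u₂ : u₀ ≢ u₂
    u₁≢u₅ : u₁ ≢ u₅
    u₂≢u₄ : u₂ ≢ u₄
    u₃≢u₅ : u₃ ≢ u₅
    u₀≢u₂ with distinct
    ... | (_ ∷ u₀≢u₂ ∷ _) ∷ _ = u₀≢u₂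
    u₁≢u₅ with distinct
    ... | _ ∷ (_ ∷ _ ∷ _ ∷ u₁≢u₅ ∷ _) ∷ _ = u₁≢u₅
    u₂≢u₄ with distinct
    ... | _ ∷ _ ∷ (_ ∷ u₂≢u₄ ∷ _) ∷ _ = u₂≢u₄
    u₃≢u₅ with distinct
    ... | _ ∷ _ ∷ _ ∷ (_ ∷ u₃≢u₅ ∷ _) ∷ _ = u₃≢u₅

    left-square : s u₀ u₁ ℤ.* s u₁ u₂ ≡ ℤ.- (s u₅ u₀ ℤ.* s u₂ u₅)
    left-square = begin
      s u₀ u₁ ℤ.* s u₁ u₂        ≡⟨ four-cycle-sign ea eb (∼-sym G ef) (∼-sym G eg) u₁≢u₅ u₀≢u₂ ⟩
      ℤ.- (s u₀ u₅ ℤ.* s u₅ u₂)  ≡⟨ cong ℤ.-_ (cong₂ ℤ._*_ (s-sym u₀ u₅) (s-sym u₅ u₂)) ⟩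
      ℤ.- (s u₅ u₀ ℤ.* s u₂ u₅)  ∎

    right-square : s u₂ u₃ ℤ.* s u₃ u₄ ≡ ℤ.- (s u₂ u₅ ℤ.* s u₄ u₅)
    right-square = begin
      s u₂ u₃ ℤ.* s u₃ u₄        ≡⟨ four-cycle-sign ec ed eg (∼-sym G ee) u₃≢u₅ u₂≢u₄ ⟩
      ℤ.- (s u₂ u₅ ℤ.* s u₅ u₄)  ≡⟨ cong (λ x → ℤ.- (s u₂ u₅ ℤ.* x)) (s-sym u₅ u₄) ⟩
      ℤ.- (s u₂ u₅ ℤ.* s u₄ u₅)  ∎

lemma4p10 : (R : CompleteOrderedField) (Γ : Graph 56) → IsSRG 56 Γ 10 0 2 →
    qEquals R Γ 2 →
    (M : Matrix R 56) → InS R Γ M → IsGram R M → (∀ i j → (_·_ R M M) i j ≡ M i j) →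
    (C : Crossbar6 Γ) → IsEvenCycle R M C
lemma4p10 R Γ (_ , triangle-free , two-common) _ M M∈S _ M²≡M =
  IdempotentPattern.crossbar-even R Γ triangle-free two-common M M∈S M²≡M
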